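{- Let $m\ge 2$, let $\lambda=(1,\dots,1)$ be the one-column shape with $m$ rows, and let $\widetilde{\lambda}=(2,1,\dots,1)$ be the $(m-1)$-row hook shape with $m$ boxes (first row of length $2$, remaining $m-2$ rows of length $1$). Then for every integer $i>T_{m-2}$ we have $|S_i(\lambda)|=|S_{i-m+1}(\widetilde{\lambda})|$. Moreover, for each such $i$ there exists a bijection $\phi:S_i(\lambda)\to S_{i-m+1}(\widetilde{\lambda})$ such that, whenever the top entry of $\tau\in S_i(\lambda)$ is $k$, the unique entry in the second column of $\phi(\tau)$ is also $k$.
   Context: For a shape $\mu$ with $N$ boxes, a tableau of shape $\mu$ is a bijective filling of the left-justified Young diagram with $1,\dots,N$; it is row-standard if entries increase left to right along each row. For a row-standard tableau $\tau$, a pair of entries $i<j$ in the same column is an inversion if either (1) $i$ or $j$ has no entry immediately to its right and $i$ lies below $j$, or (2) $i$ is immediately followed on its right by $i'$, $j$ is immediately followed on its right by $j'$, and $i'>j'$. $S_i(\mu)$ is the set of row-standard tableaux of shape $\mu$ with exactly $i$ inversions (empty if $i<0$). $T_k=k(k+1)/2$ is the $k$-th triangular number, with $T_0=0$. -}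

module Defs where

open import Data.Bool using (Bool; true; false; _∧_; _∨_; not; if_then_else_; T)
open import Data.Nat using (ℕ; zero; suc; _+_; _∸_; _⊔_; _<ᵇ_; _≡ᵇ_)
open import Data.List using (List; []; _∷_; map; concat; length; replicate; foldr; upTo; filter)
open import Data.Nat.ListAction using (sum)
open import Data.Maybe using (Maybe; just; nothing; is-nothing)
open import Data.Product using (Σ)

allᵇ : {A : Set} → (A → Bool) → List A → Bool
allᵇ p [] = true
allᵇ p (x ∷ xs) = p x ∧ allᵇ p xs

Tri : ℕ → ℕ
Tri zero = 0
Tri (suc k) = suc k + Tri k

-- A shape is the list of row lengths, top row first (English convention).
Shape : Set
Shape = List ℕ

-- A tableau (filling) is the list of its rows, top row first, each row read left to right.
Tableau : Set
Tableau = List (List ℕ)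

size : Shape → ℕ
size μ = sum μ

-- entry at row r, column c (0-indexed); nothing if there is no box there
nth : {A : Set} → List A → ℕ → Maybe A
nth [] _ = nothing
nth (x ∷ xs) zero = just x
nth (x ∷ xs) (suc n) = nth xs n

entry : Tableau → ℕ → ℕ → Maybe ℕ
entry t r c with nth t r
... | nothing = nothing
... | just row = nth row c

eqListℕ : List ℕ → List ℕ → Bool
eqListℕ [] [] = true
eqListℕ (x ∷ xs) (y ∷ ys) = (x ≡ᵇ y) ∧ eqListℕ xs ys
eqListℕ _ _ = false

hasShapeᵇ : Shape → Tableau → Bool
hasShapeᵇ μ t = eqListℕ (map length t) μ

occ : ℕ → List ℕ → ℕ
occ k [] = 0
occ k (x ∷ xs) = (if k ≡ᵇ x then 1 else 0) + occ k xs

isFillingᵇ : ℕ → Tableau → Bool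
isFillingᵇ N t = (length (concat t) ≡ᵇ N)
               ∧ allᵇ (λ k → occ (suc k) (concat t) ≡ᵇ 1) (upTo N)

increasingᵇ : List ℕ → Bool
increasingᵇ [] = true
increasingᵇ (x ∷ []) = true
increasingᵇ (x ∷ y ∷ xs) = (x <ᵇ y) ∧ increasingᵇ (y ∷ xs)

rowStandardᵇ : Tableau → Bool
rowStandardᵇ t = allᵇ increasingᵇ t

bothJust : Maybe ℕ → Maybe ℕ → Bool
bothJust (just _) (just _) = true
bothJust _ _ = false

gtM : Maybe ℕ → Maybe ℕ → Bool
gtM (just a) (just b) = b <ᵇ a
gtM _ _ = false

-- Given the smaller entry i (in row ri, right neighbour i') and the larger
-- entry j (row rj, right neighbour j') of a column pair, is it an inversion?
-- (1) i or j has no entry to its right, and i lies below j (ri > rj);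
-- (2) both have right neighbours i', j' and i' > j'.
invCond : ℕ → Maybe ℕ → ℕ → Maybe ℕ → Bool
invCond ri i' rj j' =
  ((is-nothing i' ∨ is-nothing j') ∧ (rj <ᵇ ri))
  ∨ (bothJust i' j' ∧ gtM i' j')

invPairᵇ : Tableau → ℕ → ℕ → ℕ → Bool
invPairᵇ t r1 r2 c with entry t r1 c | entry t r2 c
... | just x | just y =
  if x <ᵇ y then invCond r1 (entry t r1 (suc c)) r2 (entry t r2 (suc c))
  else (if y <ᵇ x then invCond r2 (entry t r2 (suc c)) r1 (entry t r1 (suc c))
        else false)
... | _ | _ = false

width : Tableau → ℕ
width t = foldr _⊔_ 0 (map length t)

countTrue : List Bool → ℕ
countTrue [] = 0
countTrue (b ∷ bs) = (if b then 1 else 0) + countTrue bs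

inversions : Tableau → ℕ
inversions t =
  sum (map (λ c →
    sum (map (λ r2 →
      countTrue (map (λ r1 → invPairᵇ t r1 r2 c) (upTo r2)))
      (upTo (length t))))
    (upTo (width t)))

inSᵇ : ℕ → Shape → Tableau → Bool
inSᵇ i μ t = hasShapeᵇ μ t ∧ isFillingᵇ (size μ) t ∧ rowStandardᵇ t ∧ (inversions t ≡ᵇ i)

-- the set S_i(μ) as a type (membership proof is T of a Bool, hence unique)
S : ℕ → Shape → Set
S i μ = Σ Tableau (λ t → T (inSᵇ i μ t))

column : ℕ → Shape
column m = replicate m 1

hook : ℕ → Shape
hook m = 2 ∷ replicate (m ∸ 2) 1

-- A row-standard filling of the one-column shape is a permutation read from top to bottom, and its
-- inversions are those of the permutation, i.e. the digit sum f₁ + ⋯ + f_m of its Lehmer code,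
-- where f_k < m − k + 1 and the top entry is f₁ + 1. A hook tableau with top row a < b and first
-- column a, c₁, c₂, … is coded through the list b, a, c₁, …: row-standardness becomes f₂ < f₁, and
-- as b is alone in its column, the inversions are those of a, c₁, …, namely f₂ + f₃ + ⋯ + f_m.
-- The digits f₃, …, f_m contribute at most T_{m−2} − (m − 2), so a column code with digit sum
-- i > T_{m−2} has f₁ + f₂ ≥ m − 1; replacing f₂ by f₁ + f₂ − (m − 1) is then a bijection onto the
-- hook codes with digit sum i − (m − 1), and it keeps f₁, hence the entry b = f₁ + 1.

module Submission where

open import Defs
open import Data.Bool using (Bool; true; false; T; _∧_; if_then_else_)
open import Data.Bool.Properties using (T-irrelevant)
open import Data.Empty using (⊥-elim)
open import Data.Fin using (Fin; toℕ) renaming (zero to fzero; suc to fsuc)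
open import Data.Fin.Properties using (toℕ-injective; toℕ≤pred[n]; +↔⊎)
open import Data.List using (List; []; _∷_; map; concat; length; upTo; applyUpTo)
open import Data.List.Properties using (length-map)
open import Data.Maybe using (just; nothing)
open import Data.Nat using (ℕ; zero; suc; _+_; _∸_; _≤_; _<_; _<ᵇ_; _≡ᵇ_; _≤ᵇ_; z≤n; s≤s; z<s; s<s; s≤s⁻¹; s<s⁻¹)
open import Data.Nat.ListAction using (sum)
open import Data.Nat.Properties
open import Algebra.Properties.CommutativeSemigroup +-commutativeSemigroup using (interchange; x∙yz≈y∙xz)
open import Data.Product using (Σ; _×_; _,_; proj₁; proj₂)
open import Data.Sum using (_⊎_; inj₁; inj₂)
open import Data.Sum.Function.Propositional using (_⊎-↔_)
open import Data.Unit using (⊤; tt)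
open import Function.Bundles using (_↔_; Inverse; mk↔ₛ′)
open import Function.Construct.Composition using (_↔-∘_)
open import Function.Construct.Symmetry using (↔-sym)
open import Relation.Binary.Definitions using (tri<; tri≈; tri>)
open import Relation.Binary.PropositionalEquality using (_≡_; refl; sym; trans; cong; cong₂; subst; subst₂; module ≡-Reasoning)
open import Relation.Nullary using (yes; no; ¬_)

T⇒≡true : ∀ {b} → T b → b ≡ true
T⇒≡true {true} _ = refl

¬T⇒≡false : ∀ {b} → ¬ T b → b ≡ false
¬T⇒≡false {false} _ = refl
¬T⇒≡false {true} h = ⊥-elim (h tt)

T-≡-ext : ∀ {a b : Bool} → (T a → T b) → (T b → T a) → a ≡ b
T-≡-ext {true} {true} _ _ = refl
T-≡-ext {false} {false} _ _ = refl
T-≡-ext {true} {false} f _ = ⊥-elim (f tt)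
T-≡-ext {false} {true} _ g = ⊥-elim (g tt)

T-∧-intro : ∀ {a b} → T a → T b → T (a ∧ b)
T-∧-intro {true} _ y = y

T-∧-proj₁ : ∀ {a b} → T (a ∧ b) → T a
T-∧-proj₁ {true} _ = tt

T-∧-proj₂ : ∀ {a b} → T (a ∧ b) → T b
T-∧-proj₂ {true} y = y

≡ᵇ-refl : ∀ k → (k ≡ᵇ k) ≡ true
≡ᵇ-refl k = T⇒≡true (≡⇒≡ᵇ k k refl)

≢⇒≡ᵇ≡false : ∀ {m n} → ¬ m ≡ n → (m ≡ᵇ n) ≡ false
≢⇒≡ᵇ≡false {m} {n} m≢n = ¬T⇒≡false (λ t → m≢n (≡ᵇ⇒≡ m n t))

<ᵇ-≡ : ∀ {a b x y : ℕ} → (a < b → x < y) → (x < y → a < b) → (a <ᵇ b) ≡ (x <ᵇ y)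
<ᵇ-≡ {a} {b} {x} {y} f g = T-≡-ext (λ t → <⇒<ᵇ (f (<ᵇ⇒< a b t))) (λ t → <⇒<ᵇ (g (<ᵇ⇒< x y t)))

Subtype : {A : Set} → (A → Bool) → Set
Subtype {A} p = Σ A (λ a → T (p a))

subtype-≡ : ∀ {A : Set} {p : A → Bool} {a b : A} {pa : T (p a)} {pb : T (p b)} →
            a ≡ b → _≡_ {A = Subtype p} (a , pa) (b , pb)
subtype-≡ {a = a} refl = cong (a ,_) (T-irrelevant _ _)

restrict-↔ : ∀ {A B : Set} (p : A → Bool) (q : B → Bool) (f : A → B) (g : B → A) →
  (∀ a → T (p a) → T (q (f a))) → (∀ b → T (q b) → T (p (g b))) →
  (∀ a → T (p a) → g (f a) ≡ a) → (∀ b → T (q b) → f (g b) ≡ b) →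
  Subtype p ↔ Subtype q
restrict-↔ p q f g pf qg gf fg =
  mk↔ₛ′ (λ (a , pa) → f a , pf a pa)
        (λ (b , qb) → g b , qg b qb)
        (λ (b , qb) → subtype-≡ {p = q} (fg b qb))
        (λ (a , pa) → subtype-≡ {p = p} (gf a pa))

Finite : Set → Set
Finite A = Σ ℕ (λ n → A ↔ Fin n)

Finite-↔ : ∀ {A B : Set} → A ↔ B → Finite B → Finite A
Finite-↔ A↔B (n , B↔n) = n , (B↔n ↔-∘ A↔B)

Finite-T : ∀ b → Finite (T b)
Finite-T true = 1 , mk↔ₛ′ (λ _ → fzero) (λ _ → tt) (λ { fzero → refl ; (fsuc ()) }) (λ { tt → refl })
Finite-T false = 0 , mk↔ₛ′ (λ ()) (λ ()) (λ ()) (λ ())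

Σ-Fin-suc-↔ : ∀ k (B : Fin (suc k) → Set) → Σ (Fin (suc k)) B ↔ (B fzero ⊎ Σ (Fin k) (λ f → B (fsuc f)))
Σ-Fin-suc-↔ k B = mk↔ₛ′
  (λ { (fzero , b) → inj₁ b ; (fsuc f , b) → inj₂ (f , b) })
  (λ { (inj₁ b) → fzero , b ; (inj₂ (f , b)) → fsuc f , b })
  (λ { (inj₁ b) → refl ; (inj₂ (f , b)) → refl })
  (λ { (fzero , b) → refl ; (fsuc f , b) → refl })

Finite-Σ-Fin : ∀ k (B : Fin k → Set) → (∀ f → Finite (B f)) → Finite (Σ (Fin k) B)
Finite-Σ-Fin zero B _ = 0 , mk↔ₛ′ (λ ()) (λ ()) (λ ()) (λ ())
Finite-Σ-Fin (suc k) B fin with fin fzero | Finite-Σ-Fin k (λ f → B (fsuc f)) (λ f → fin (fsuc f))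
... | (n₀ , e₀) | (n₁ , e₁) = n₀ + n₁ , (↔-sym +↔⊎ ↔-∘ ((e₀ ⊎-↔ e₁) ↔-∘ Σ-Fin-suc-↔ k B))

-- `bump c` and `unbump c` are mutually inverse bijections ℕ ≃ ℕ ∖ {suc c}, used to re-index
-- the entries of a list after removing its head `suc c`.
bump : ℕ → ℕ → ℕ
bump c y = if y ≤ᵇ c then y else suc y

unbump : ℕ → ℕ → ℕ
unbump c y = if y ≤ᵇ c then y else y ∸ 1

bump-≤ : ∀ {c y} → y ≤ c → bump c y ≡ y
bump-≤ y≤c rewrite T⇒≡true (≤⇒≤ᵇ y≤c) = refl

bump-> : ∀ {c y} → c < y → bump c y ≡ suc y
bump-> {c} {y} c<y rewrite ¬T⇒≡false (λ t → <⇒≱ c<y (≤ᵇ⇒≤ y c t)) = refl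

unbump-≤ : ∀ {c y} → y ≤ c → unbump c y ≡ y
unbump-≤ y≤c rewrite T⇒≡true (≤⇒≤ᵇ y≤c) = refl

unbump-> : ∀ {c y} → c < y → unbump c y ≡ y ∸ 1
unbump-> {c} {y} c<y rewrite ¬T⇒≡false (λ t → <⇒≱ c<y (≤ᵇ⇒≤ y c t)) = refl

unbump-bump : ∀ c y → unbump c (bump c y) ≡ y
unbump-bump c y with y ≤? c
... | yes y≤c rewrite bump-≤ y≤c = unbump-≤ y≤c
... | no y≰c rewrite bump-> (≰⇒> y≰c) = unbump-> {c} {suc y} (m≤n⇒m≤1+n (≰⇒> y≰c))

bump-unbump : ∀ c y → ¬ y ≡ suc c → bump c (unbump c y) ≡ y
bump-unbump c y y≢1+c with y ≤? c
... | yes y≤c rewrite unbump-≤ y≤c = bump-≤ y≤c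
bump-unbump c zero _ | no y≰c = ⊥-elim (y≰c z≤n)
bump-unbump c (suc y) y≢1+c | no y≰c rewrite unbump-> {c} {suc y} (≰⇒> y≰c) =
  bump-> (≤∧≢⇒< (s≤s⁻¹ (≰⇒> y≰c)) (λ c≡y → y≢1+c (cong suc (sym c≡y))))

bump-injective : ∀ c {x y} → bump c x ≡ bump c y → x ≡ y
bump-injective c {x} {y} e = begin
  x                   ≡⟨ sym (unbump-bump c x) ⟩
  unbump c (bump c x) ≡⟨ cong (unbump c) e ⟩
  unbump c (bump c y) ≡⟨ unbump-bump c y ⟩
  y                   ∎
  where open ≡-Reasoning

bump-≢ : ∀ c y → ¬ bump c y ≡ suc c
bump-≢ c y e with y ≤? c
... | yes y≤c = <-irrefl refl (≤-trans (s≤s y≤c) (≤-reflexive (trans (sym e) (bump-≤ y≤c))))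
... | no y≰c = <-irrefl (sym (suc-injective (trans (sym (bump-> (≰⇒> y≰c))) e))) (≰⇒> y≰c)

bump-<-mono : ∀ c {x y} → y < x → bump c y < bump c x
bump-<-mono c {x} {y} y<x with y ≤? c | x ≤? c
... | yes y≤c | yes x≤c rewrite bump-≤ y≤c | bump-≤ x≤c = y<x
... | yes y≤c | no x≰c rewrite bump-≤ y≤c | bump-> (≰⇒> x≰c) = m≤n⇒m≤1+n y<x
... | no y≰c | yes x≤c = ⊥-elim (y≰c (≤-trans (<⇒≤ y<x) x≤c))
... | no y≰c | no x≰c rewrite bump-> (≰⇒> y≰c) | bump-> (≰⇒> x≰c) = s<s y<x

bump-<-reflect : ∀ c {x y} → bump c y < bump c x → y < x
bump-<-reflect c {x} {y} lt with <-cmp y x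
... | tri< y<x _ _ = y<x
... | tri≈ _ refl _ = ⊥-elim (<-irrefl refl lt)
... | tri> _ _ x<y = ⊥-elim (<-asym lt (bump-<-mono c x<y))

map-unbump-bump : ∀ c ys → map (unbump c) (map (bump c) ys) ≡ ys
map-unbump-bump c [] = refl
map-unbump-bump c (y ∷ ys) = cong₂ _∷_ (unbump-bump c y) (map-unbump-bump c ys)

indicator : Bool → ℕ
indicator b = if b then 1 else 0

occ≡0⇒≢head : ∀ {k x} xs → occ k (x ∷ xs) ≡ 0 → ¬ k ≡ x
occ≡0⇒≢head {x = x} xs e refl rewrite ≡ᵇ-refl x with e
... | ()

occ≡0-tail : ∀ {k} x xs → occ k (x ∷ xs) ≡ 0 → occ k xs ≡ 0
occ≡0-tail {k} x xs e = m+n≡0⇒n≡0 (indicator (k ≡ᵇ x)) e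

map-bump-unbump : ∀ c ys → occ (suc c) ys ≡ 0 → map (bump c) (map (unbump c) ys) ≡ ys
map-bump-unbump c [] _ = refl
map-bump-unbump c (y ∷ ys) h =
  cong₂ _∷_ (bump-unbump c y (λ e → occ≡0⇒≢head ys h (sym e))) (map-bump-unbump c ys (occ≡0-tail y ys h))

occ-map-bump : ∀ c y ys → occ (bump c y) (map (bump c) ys) ≡ occ y ys
occ-map-bump c y [] = refl
occ-map-bump c y (x ∷ xs) = cong₂ (λ b n → indicator b + n)
  (T-≡-ext (λ t → ≡⇒≡ᵇ y x (bump-injective c (≡ᵇ⇒≡ _ _ t)))
           (λ t → ≡⇒≡ᵇ _ _ (cong (bump c) (≡ᵇ⇒≡ y x t))))
  (occ-map-bump c y xs)

occ-map-bump-≡0 : ∀ c ys → occ (suc c) (map (bump c) ys) ≡ 0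
occ-map-bump-≡0 c [] = refl
occ-map-bump-≡0 c (x ∷ xs)
  rewrite ≢⇒≡ᵇ≡false {suc c} {bump c x} (λ e → bump-≢ c x (sym e)) = occ-map-bump-≡0 c xs

occ-map-unbump : ∀ c y ys → occ (suc c) ys ≡ 0 → occ y (map (unbump c) ys) ≡ occ (bump c y) ys
occ-map-unbump c y ys h = begin
  occ y (map (unbump c) ys)                         ≡⟨ sym (occ-map-bump c y (map (unbump c) ys)) ⟩
  occ (bump c y) (map (bump c) (map (unbump c) ys)) ≡⟨ cong (occ (bump c y)) (map-bump-unbump c ys h) ⟩
  occ (bump c y) ys                                 ∎
  where open ≡-Reasoning

IsFilling : ℕ → List ℕ → Set
IsFilling N w = length w ≡ N × (∀ k → k < N → occ (suc k) w ≡ 1)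

T-allᵇ-applyUpTo⁻ : ∀ {A : Set} (p : A → Bool) (g : ℕ → A) N →
  T (allᵇ p (applyUpTo g N)) → ∀ k → k < N → T (p (g k))
T-allᵇ-applyUpTo⁻ p g (suc N) h zero _ = T-∧-proj₁ h
T-allᵇ-applyUpTo⁻ p g (suc N) h (suc k) k<N =
  T-allᵇ-applyUpTo⁻ p (λ x → g (suc x)) N (T-∧-proj₂ {p (g 0)} h) k (s<s⁻¹ k<N)

T-allᵇ-applyUpTo⁺ : ∀ {A : Set} (p : A → Bool) (g : ℕ → A) N →
  (∀ k → k < N → T (p (g k))) → T (allᵇ p (applyUpTo g N))
T-allᵇ-applyUpTo⁺ p g zero h = tt
T-allᵇ-applyUpTo⁺ p g (suc N) h =
  T-∧-intro (h 0 z<s) (T-allᵇ-applyUpTo⁺ p (λ x → g (suc x)) N (λ k k<N → h (suc k) (s<s k<N)))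

isFillingᵇ⇒IsFilling : ∀ N t → T (isFillingᵇ N t) → IsFilling N (concat t)
isFillingᵇ⇒IsFilling N t h = ≡ᵇ⇒≡ _ _ (T-∧-proj₁ h) , λ k k<N →
  ≡ᵇ⇒≡ _ _ (T-allᵇ-applyUpTo⁻ (λ k → occ (suc k) (concat t) ≡ᵇ 1) (λ x → x) N
                               (T-∧-proj₂ {length (concat t) ≡ᵇ N} h) k k<N)

IsFilling⇒isFillingᵇ : ∀ N t → IsFilling N (concat t) → T (isFillingᵇ N t)
IsFilling⇒isFillingᵇ N t (len , occs) = T-∧-intro (≡⇒≡ᵇ _ _ len)
  (T-allᵇ-applyUpTo⁺ (λ k → occ (suc k) (concat t) ≡ᵇ 1) (λ x → x) N (λ k k<N → ≡⇒≡ᵇ _ _ (occs k k<N)))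

inRange : ℕ → ℕ → ℕ → ℕ
inRange a zero y = 0
inRange a (suc N) y = indicator (a ≡ᵇ y) + inRange (suc a) N y

occRange : ℕ → ℕ → List ℕ → ℕ
occRange a zero w = 0
occRange a (suc N) w = occ a w + occRange (suc a) N w

occRange-[] : ∀ a N → occRange a N [] ≡ 0
occRange-[] a zero = refl
occRange-[] a (suc N) = occRange-[] (suc a) N

occRange-∷ : ∀ a N y ys → occRange a N (y ∷ ys) ≡ inRange a N y + occRange a N ys
occRange-∷ a zero y ys = refl
occRange-∷ a (suc N) y ys rewrite occRange-∷ (suc a) N y ys =
  interchange (indicator (a ≡ᵇ y)) (occ a ys) (inRange (suc a) N y) (occRange (suc a) N ys)

inRange-< : ∀ a N y → y < a → inRange a N y ≡ 0
inRange-< a zero y _ = refl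
inRange-< a (suc N) y y<a rewrite ≢⇒≡ᵇ≡false {a} {y} (λ a≡y → <-irrefl (sym a≡y) y<a) =
  inRange-< (suc a) N y (m≤n⇒m≤1+n y<a)

inRange-≥ : ∀ a N y → a + N ≤ y → inRange a N y ≡ 0
inRange-≥ a zero y _ = refl
inRange-≥ a (suc N) y a+N≤y
  rewrite +-suc a N | ≢⇒≡ᵇ≡false {a} {y} (λ a≡y → <-irrefl a≡y (m+n≤o⇒m≤o (suc a) a+N≤y)) =
  inRange-≥ (suc a) N y a+N≤y

inRange-≤1 : ∀ a N y → inRange a N y ≤ 1
inRange-≤1 a zero y = z≤n
inRange-≤1 a (suc N) y with a ≟ y
... | yes refl rewrite ≡ᵇ-refl a | inRange-< (suc a) N a ≤-refl = ≤-refl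
... | no a≢y rewrite ≢⇒≡ᵇ≡false a≢y = inRange-≤1 (suc a) N y

occRange-≤-length : ∀ a N w → occRange a N w ≤ length w
occRange-≤-length a N [] = ≤-reflexive (occRange-[] a N)
occRange-≤-length a N (y ∷ ys) rewrite occRange-∷ a N y ys =
  +-mono-≤ (inRange-≤1 a N y) (occRange-≤-length a N ys)

occRange-all-1 : ∀ a N w → (∀ k → k < N → occ (a + k) w ≡ 1) → occRange a N w ≡ N
occRange-all-1 a zero w h = refl
occRange-all-1 a (suc N) w h = cong₂ _+_ (subst (λ z → occ z w ≡ 1) (+-identityʳ a) (h 0 z<s))
  (occRange-all-1 (suc a) N w (λ k k<N → subst (λ z → occ z w ≡ 1) (+-suc a k) (h (suc k) (s<s k<N))))

-- Pigeonhole: the N values 1, …, N already fill all N places of the list.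
IsFilling-head-bounds : ∀ n x xs → IsFilling (suc n) (x ∷ xs) → 1 ≤ x × x ≤ suc n
IsFilling-head-bounds n x xs (len , occs) = lower , upper
  where
  total : inRange 1 (suc n) x + occRange 1 (suc n) xs ≡ suc n
  total = trans (sym (occRange-∷ 1 (suc n) x xs)) (occRange-all-1 1 (suc n) (x ∷ xs) occs)
  inRange≢0 : ¬ inRange 1 (suc n) x ≡ 0
  inRange≢0 e = <-irrefl refl
    (≤-trans (≤-reflexive (trans (sym total) (cong (_+ occRange 1 (suc n) xs) e)))
             (≤-trans (occRange-≤-length 1 (suc n) xs) (≤-reflexive (suc-injective len))))
  lower : 1 ≤ x
  lower with 1 ≤? x
  ... | yes 1≤x = 1≤x
  ... | no 1≰x = ⊥-elim (inRange≢0 (inRange-< 1 (suc n) x (≰⇒> 1≰x)))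
  upper : x ≤ suc n
  upper with x ≤? suc n
  ... | yes x≤n = x≤n
  ... | no x≰n = ⊥-elim (inRange≢0 (inRange-≥ 1 (suc n) x (≰⇒> x≰n)))

-- Lehmer codes

Code : ℕ → Set
Code zero = ⊤
Code (suc n) = Fin (suc n) × Code n

digitSum : ∀ n → Code n → ℕ
digitSum zero _ = 0
digitSum (suc n) (f , cs) = toℕ f + digitSum n cs

Finite-Subtype-Code : ∀ n (q : Code n → Bool) → Finite (Subtype q)
Finite-Subtype-Code zero q = Finite-↔ unit-↔ (Finite-T (q tt))
  where
  unit-↔ : Subtype q ↔ T (q tt)
  unit-↔ = mk↔ₛ′ (λ { (tt , p) → p }) (λ p → tt , p) (λ _ → refl) (λ { (tt , p) → refl })
Finite-Subtype-Code (suc n) q =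
  Finite-↔ curry-↔ (Finite-Σ-Fin (suc n) _ (λ f → Finite-Subtype-Code n (λ cs → q (f , cs))))
  where
  curry-↔ : Subtype q ↔ Σ (Fin (suc n)) (λ f → Subtype (λ cs → q (f , cs)))
  curry-↔ = mk↔ₛ′ (λ ((f , cs) , p) → f , cs , p) (λ (f , cs , p) → (f , cs) , p)
                  (λ _ → refl) (λ _ → refl)

-- Saturates at n, so that encode is total; only its values on x ≤ n matter.
clamp : ∀ n → ℕ → Fin (suc n)
clamp zero _ = fzero
clamp (suc n) zero = fzero
clamp (suc n) (suc x) = fsuc (clamp n x)

toℕ-clamp : ∀ n {x} → x ≤ n → toℕ (clamp n x) ≡ x
toℕ-clamp zero z≤n = refl
toℕ-clamp (suc n) z≤n = refl
toℕ-clamp (suc n) (s≤s x≤n) = cong suc (toℕ-clamp n x≤n)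

clamp-toℕ : ∀ n (f : Fin (suc n)) → clamp n (toℕ f) ≡ f
clamp-toℕ n f = toℕ-injective (toℕ-clamp n (toℕ≤pred[n] f))

decode : ∀ n → Code n → List ℕ
decode zero _ = []
decode (suc n) (f , cs) = suc (toℕ f) ∷ map (bump (toℕ f)) (decode n cs)

encode : ∀ n → List ℕ → Code n
encode zero _ = tt
encode (suc n) [] = fzero , encode n []
encode (suc n) (x ∷ xs) = clamp n (x ∸ 1) , encode n (map (unbump (x ∸ 1)) xs)

length-decode : ∀ n cs → length (decode n cs) ≡ n
length-decode zero _ = refl
length-decode (suc n) (f , cs) = cong suc (trans (length-map _ (decode n cs)) (length-decode n cs))

encode-decode : ∀ n cs → encode n (decode n cs) ≡ cs
encode-decode zero tt = refl
encode-decode (suc n) (f , cs) = cong₂ _,_ (clamp-toℕ n f)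
  (trans (cong (encode n) (map-unbump-bump (toℕ f) (decode n cs))) (encode-decode n cs))

decode-IsFilling : ∀ n cs → IsFilling n (decode n cs)
decode-IsFilling zero tt = refl , λ k ()
decode-IsFilling (suc n) (f , cs) = length-decode (suc n) (f , cs) , occs
  where
  c : ℕ
  c = toℕ f
  ys : List ℕ
  ys = decode n cs
  occs : ∀ k → k < suc n → occ (suc k) (suc c ∷ map (bump c) ys) ≡ 1
  occs k k<1+n with k ≟ c
  ... | yes refl rewrite ≡ᵇ-refl c | occ-map-bump-≡0 c ys = refl
  ... | no k≢c rewrite ≢⇒≡ᵇ≡false {k} {c} k≢c with <-cmp k c
  ...   | tri< k<c _ _ = trans (cong (λ z → occ z (map (bump c) ys)) (sym (bump-≤ k<c)))
                          (trans (occ-map-bump c (suc k) ys)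
                                 (proj₂ (decode-IsFilling n cs) k (≤-trans k<c (toℕ≤pred[n] f))))
  ...   | tri≈ _ k≡c _ = ⊥-elim (k≢c k≡c)
  ...   | tri> _ _ c<k = above k c<k k<1+n
    where
    above : ∀ k → c < k → k < suc n → occ (suc k) (map (bump c) ys) ≡ 1
    above (suc k) c<k k<1+n = trans (cong (λ z → occ z (map (bump c) ys)) (sym (bump-> c<k)))
      (trans (occ-map-bump c (suc k) ys) (proj₂ (decode-IsFilling n cs) k (s≤s⁻¹ k<1+n)))

IsFilling-head-occ≡0 : ∀ {N} c xs → IsFilling N (suc c ∷ xs) → c < N → occ (suc c) xs ≡ 0
IsFilling-head-occ≡0 c xs (_ , occs) c<N =
  suc-injective (trans (cong (λ b → indicator b + occ (suc c) xs) (sym (≡ᵇ-refl c))) (occs c c<N))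

IsFilling-unbump-tail : ∀ n c xs → IsFilling (suc n) (suc c ∷ xs) → c ≤ n → IsFilling n (map (unbump c) xs)
IsFilling-unbump-tail n c xs (len , occs) c≤n = trans (length-map _ xs) (suc-injective len) , occs′
  where
  preimage : ∀ k → k < n → Σ ℕ (λ j → j < suc n × bump c (suc k) ≡ suc j)
  preimage k k<n with suc k ≤? c
  ... | yes 1+k≤c = k , m≤n⇒m≤1+n k<n , bump-≤ 1+k≤c
  ... | no 1+k≰c = suc k , s≤s k<n , bump-> (≰⇒> 1+k≰c)
  occs′ : ∀ k → k < n → occ (suc k) (map (unbump c) xs) ≡ 1
  occs′ k k<n with preimage k k<n
  ... | (j , j<1+n , e) = begin
    occ (suc k) (map (unbump c) xs)              ≡⟨ occ-map-unbump c (suc k) xs (IsFilling-head-occ≡0 c xs (len , occs) (s≤s c≤n)) ⟩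
    occ (bump c (suc k)) xs                      ≡⟨ cong (λ z → occ z xs) e ⟩
    occ (suc j) xs                               ≡⟨ cong (λ b → indicator b + occ (suc j) xs) (sym j≢c) ⟩
    occ (suc j) (suc c ∷ xs)                     ≡⟨ occs j j<1+n ⟩
    1                                            ∎
    where
    open ≡-Reasoning
    j≢c : (suc j ≡ᵇ suc c) ≡ false
    j≢c = ≢⇒≡ᵇ≡false (λ e′ → bump-≢ c (suc k) (trans e e′))

decode-encode : ∀ n w → IsFilling n w → decode n (encode n w) ≡ w
decode-encode zero [] _ = refl
decode-encode (suc n) (zero ∷ xs) h with IsFilling-head-bounds n zero xs h
... | () , _
decode-encode (suc n) (suc c ∷ xs) h with s≤s⁻¹ (proj₂ (IsFilling-head-bounds n (suc c) xs h))
... | c≤n rewrite toℕ-clamp n c≤n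
                | decode-encode n (map (unbump c) xs) (IsFilling-unbump-tail n c xs h c≤n)
                | map-bump-unbump c xs (IsFilling-head-occ≡0 c xs h (s≤s c≤n)) = refl

countLess : ℕ → List ℕ → ℕ
countLess x [] = 0
countLess x (y ∷ ys) = indicator (y <ᵇ x) + countLess x ys

listInversions : List ℕ → ℕ
listInversions [] = 0
listInversions (x ∷ xs) = countLess x xs + listInversions xs

countLess-map : ∀ (g : ℕ → ℕ) a b ys → (∀ y → (g y <ᵇ a) ≡ (y <ᵇ b)) →
                countLess a (map g ys) ≡ countLess b ys
countLess-map g a b [] _ = refl
countLess-map g a b (y ∷ ys) h = cong₂ (λ u v → indicator u + v) (h y) (countLess-map g a b ys h)

listInversions-map-bump : ∀ c ys → listInversions (map (bump c) ys) ≡ listInversions ys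
listInversions-map-bump c [] = refl
listInversions-map-bump c (x ∷ xs) = cong₂ _+_
  (countLess-map (bump c) (bump c x) x xs (λ y → <ᵇ-≡ {bump c y} {bump c x} {y} {x} (bump-<-reflect c) (bump-<-mono c)))
  (listInversions-map-bump c xs)

bump-<ᵇ-≥ : ∀ {f c} y → c ≤ f → (bump f y <ᵇ suc c) ≡ (y <ᵇ suc c)
bump-<ᵇ-≥ {f} {c} y c≤f with y ≤? f
... | yes y≤f rewrite bump-≤ y≤f = refl
... | no y≰f rewrite bump-> (≰⇒> y≰f) =
  <ᵇ-≡ {suc y} {suc c} {y} {suc c} (λ 1+y<1+c → ⊥-elim (<-asym (s≤s⁻¹ 1+y<1+c) c<y))
                                   (λ y<1+c → ⊥-elim (<⇒≱ c<y (s≤s⁻¹ y<1+c)))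
  where
  c<y : c < y
  c<y = ≤-<-trans c≤f (≰⇒> y≰f)

bump-<ᵇ-< : ∀ {f c} y → f ≤ c → (bump f y <ᵇ suc (suc c)) ≡ (y <ᵇ suc c)
bump-<ᵇ-< {f} {c} y f≤c with y ≤? f
... | yes y≤f rewrite bump-≤ y≤f = <ᵇ-≡ (λ _ → s≤s (≤-trans y≤f f≤c)) m≤n⇒m≤1+n
... | no y≰f rewrite bump-> (≰⇒> y≰f) = <ᵇ-≡ {suc y} {suc (suc c)} {y} {suc c} s≤s⁻¹ s≤s

countLess-decode : ∀ n cs c → c ≤ n → countLess (suc c) (decode n cs) ≡ c
countLess-decode zero tt zero _ = refl
countLess-decode (suc n) (f , cs) c c≤1+n with c ≤? toℕ f
... | yes c≤f rewrite ¬T⇒≡false {suc (toℕ f) <ᵇ suc c} (λ t → <⇒≱ (<ᵇ⇒< _ _ t) (s≤s c≤f)) =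
  trans (countLess-map (bump (toℕ f)) (suc c) (suc c) (decode n cs) (λ y → bump-<ᵇ-≥ y c≤f))
        (countLess-decode n cs c (≤-trans c≤f (toℕ≤pred[n] f)))
countLess-decode (suc n) (f , cs) zero _ | no c≰f = ⊥-elim (c≰f z≤n)
countLess-decode (suc n) (f , cs) (suc c) 1+c≤1+n | no 1+c≰f
  rewrite T⇒≡true (<⇒<ᵇ {suc (toℕ f)} {suc (suc c)} (s≤s (≰⇒> 1+c≰f))) =
  cong suc (trans (countLess-map (bump (toℕ f)) (suc (suc c)) (suc c) (decode n cs)
                                 (λ y → bump-<ᵇ-< y (s≤s⁻¹ (≰⇒> 1+c≰f))))
                  (countLess-decode n cs c (s≤s⁻¹ 1+c≤1+n)))

listInversions-decode : ∀ n cs → listInversions (decode n cs) ≡ digitSum n cs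
listInversions-decode zero tt = refl
listInversions-decode (suc n) (f , cs) = cong₂ _+_
  (trans (countLess-map (bump (toℕ f)) (suc (toℕ f)) (suc (toℕ f)) (decode n cs) (λ y → bump-<ᵇ-≥ y ≤-refl))
         (countLess-decode n cs (toℕ f) (toℕ≤pred[n] f)))
  (trans (listInversions-map-bump (toℕ f) (decode n cs)) (listInversions-decode n cs))

-- Inversions of tableaux whose second column is at most the top box

sumTo : (ℕ → ℕ) → ℕ → ℕ
sumTo h zero = 0
sumTo h (suc N) = h 0 + sumTo (λ k → h (suc k)) N

countTo : (ℕ → Bool) → ℕ → ℕ
countTo p = sumTo (λ k → indicator (p k))

sum-map-applyUpTo : ∀ (h g : ℕ → ℕ) N → sum (map h (applyUpTo g N)) ≡ sumTo (λ k → h (g k)) N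
sum-map-applyUpTo h g zero = refl
sum-map-applyUpTo h g (suc N) = cong (h (g 0) +_) (sum-map-applyUpTo h (λ k → g (suc k)) N)

countTrue-map-applyUpTo : ∀ (p : ℕ → Bool) (g : ℕ → ℕ) N →
                          countTrue (map p (applyUpTo g N)) ≡ countTo (λ k → p (g k)) N
countTrue-map-applyUpTo p g zero = refl
countTrue-map-applyUpTo p g (suc N) = cong (indicator (p (g 0)) +_) (countTrue-map-applyUpTo p (λ k → g (suc k)) N)

sumTo-cong : ∀ h h′ N → (∀ k → k < N → h k ≡ h′ k) → sumTo h N ≡ sumTo h′ N
sumTo-cong h h′ zero _ = refl
sumTo-cong h h′ (suc N) e = cong₂ _+_ (e 0 z<s)
  (sumTo-cong (λ k → h (suc k)) (λ k → h′ (suc k)) N (λ k k<N → e (suc k) (s<s k<N)))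

sumTo-+ : ∀ h h′ N → sumTo (λ k → h k + h′ k) N ≡ sumTo h N + sumTo h′ N
sumTo-+ h h′ zero = refl
sumTo-+ h h′ (suc N) rewrite sumTo-+ (λ k → h (suc k)) (λ k → h′ (suc k)) N =
  interchange (h 0) (h′ 0) (sumTo (λ k → h (suc k)) N) (sumTo (λ k → h′ (suc k)) N)

sumTo-≡0 : ∀ h N → (∀ k → k < N → h k ≡ 0) → sumTo h N ≡ 0
sumTo-≡0 h zero _ = refl
sumTo-≡0 h (suc N) e rewrite e 0 z<s = sumTo-≡0 (λ k → h (suc k)) N (λ k k<N → e (suc k) (s<s k<N))

-- Returns the junk value 0 past the end of the list.
lookup₀ : List ℕ → ℕ → ℕ
lookup₀ [] _ = 0
lookup₀ (x ∷ xs) zero = x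
lookup₀ (x ∷ xs) (suc n) = lookup₀ xs n

nth-lookup₀ : ∀ L r → r < length L → nth L r ≡ just (lookup₀ L r)
nth-lookup₀ (x ∷ L) zero _ = refl
nth-lookup₀ (x ∷ L) (suc r) r<len = nth-lookup₀ L r (s≤s⁻¹ r<len)

positionalInversions : List ℕ → ℕ
positionalInversions L = sumTo (λ r₂ → countTo (λ r₁ → lookup₀ L r₂ <ᵇ lookup₀ L r₁) r₂) (length L)

sumTo-lookup₀≡countLess : ∀ x L → sumTo (λ s → indicator (lookup₀ L s <ᵇ x)) (length L) ≡ countLess x L
sumTo-lookup₀≡countLess x [] = refl
sumTo-lookup₀≡countLess x (y ∷ L) = cong (indicator (y <ᵇ x) +_) (sumTo-lookup₀≡countLess x L)

positionalInversions≡listInversions : ∀ L → positionalInversions L ≡ listInversions L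
positionalInversions≡listInversions [] = refl
positionalInversions≡listInversions (x ∷ L) =
  trans (sumTo-+ (λ s → indicator (lookup₀ L s <ᵇ x))
                 (λ s → countTo (λ r₁ → lookup₀ L s <ᵇ lookup₀ L r₁) s) (length L))
        (cong₂ _+_ (sumTo-lookup₀≡countLess x L) (positionalInversions≡listInversions L))

columnInversions : Tableau → ℕ → ℕ
columnInversions t c =
  sum (map (λ r₂ → countTrue (map (λ r₁ → invPairᵇ t r₁ r₂ c) (upTo r₂))) (upTo (length t)))

columnInversions-sumTo : ∀ t c →
  columnInversions t c ≡ sumTo (λ r₂ → countTo (λ r₁ → invPairᵇ t r₁ r₂ c) r₂) (length t)
columnInversions-sumTo t c = trans (sum-map-applyUpTo _ (λ x → x) (length t))
  (sumTo-cong _ _ (length t) (λ r₂ _ → countTrue-map-applyUpTo (λ r₁ → invPairᵇ t r₁ r₂ c) (λ x → x) r₂))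

-- A box without right neighbour forces case (1) of the inversion rule, which compares rows only.
invPairᵇ-col0 : ∀ t r₁ r₂ x y → entry t r₁ 0 ≡ just x → entry t r₂ 0 ≡ just y →
                entry t r₂ 1 ≡ nothing → r₁ < r₂ → invPairᵇ t r₁ r₂ 0 ≡ (y <ᵇ x)
invPairᵇ-col0 t r₁ r₂ x y e₁ e₂ e₃ r₁<r₂ with entry t r₁ 0 | entry t r₂ 0 | e₁ | e₂
... | .(just x) | .(just y) | refl | refl with x <ᵇ y in x<y | y <ᵇ x in y<x
...   | true | true = ⊥-elim (<-asym (<ᵇ⇒< x y (subst T (sym x<y) tt)) (<ᵇ⇒< y x (subst T (sym y<x) tt)))
...   | true | false rewrite e₃ | ¬T⇒≡false {r₂ <ᵇ r₁} (λ t → <-asym r₁<r₂ (<ᵇ⇒< r₂ r₁ t)) with entry t r₁ 1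
...     | just _ = refl
...     | nothing = refl
invPairᵇ-col0 t r₁ r₂ x y e₁ e₂ e₃ r₁<r₂ | .(just x) | .(just y) | refl | refl | false | true
  rewrite e₃ | T⇒≡true (<⇒<ᵇ r₁<r₂) = refl
invPairᵇ-col0 t r₁ r₂ x y e₁ e₂ e₃ r₁<r₂ | .(just x) | .(just y) | refl | refl | false | false = refl

invPairᵇ-col1 : ∀ t r₁ r₂ → entry t r₂ 1 ≡ nothing → invPairᵇ t r₁ r₂ 1 ≡ false
invPairᵇ-col1 t r₁ r₂ e with entry t r₁ 1 | entry t r₂ 1 | e
... | just _ | .nothing | refl = refl
... | nothing | .nothing | refl = refl

record HookLike (t : Tableau) (L : List ℕ) : Set where
  field
    first-column : ∀ r → entry t r 0 ≡ nth L r
    second-column : ∀ r → entry t (suc r) 1 ≡ nothing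
    length-≡ : length t ≡ length L

columnInversions-0 : ∀ t L → HookLike t L → columnInversions t 0 ≡ listInversions L
columnInversions-0 t L hl = begin
  columnInversions t 0
    ≡⟨ columnInversions-sumTo t 0 ⟩
  sumTo (λ r₂ → countTo (λ r₁ → invPairᵇ t r₁ r₂ 0) r₂) (length t)
    ≡⟨ cong (sumTo _) length-≡ ⟩
  sumTo (λ r₂ → countTo (λ r₁ → invPairᵇ t r₁ r₂ 0) r₂) (length L)
    ≡⟨ sumTo-cong _ _ (length L) pairs ⟩
  positionalInversions L
    ≡⟨ positionalInversions≡listInversions L ⟩
  listInversions L ∎
  where
  open ≡-Reasoning
  open HookLike hl
  pairs : ∀ r₂ → r₂ < length L →
          countTo (λ r₁ → invPairᵇ t r₁ r₂ 0) r₂ ≡ countTo (λ r₁ → lookup₀ L r₂ <ᵇ lookup₀ L r₁) r₂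
  pairs zero _ = refl
  pairs (suc r) r<len = sumTo-cong _ _ (suc r) (λ r₁ r₁<r → cong indicator
    (invPairᵇ-col0 t r₁ (suc r) (lookup₀ L r₁) (lookup₀ L (suc r))
      (trans (first-column r₁) (nth-lookup₀ L r₁ (<-trans r₁<r r<len)))
      (trans (first-column (suc r)) (nth-lookup₀ L (suc r) r<len))
      (second-column r) r₁<r))

columnInversions-1 : ∀ t L → HookLike t L → columnInversions t 1 ≡ 0
columnInversions-1 t L hl = trans (columnInversions-sumTo t 1) (sumTo-≡0 _ (length t) pairs)
  where
  pairs : ∀ r₂ → r₂ < length t → countTo (λ r₁ → invPairᵇ t r₁ r₂ 1) r₂ ≡ 0
  pairs zero _ = refl
  pairs (suc r) _ = sumTo-≡0 _ (suc r) (λ r₁ _ →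
    cong indicator (invPairᵇ-col1 t r₁ (suc r) (HookLike.second-column hl r)))

columnTableau : List ℕ → Tableau
columnTableau w = map (λ x → x ∷ []) w

hookTableau : ℕ → ℕ → List ℕ → Tableau
hookTableau a b c = (a ∷ b ∷ []) ∷ columnTableau c

entry-∷ : ∀ row t r c → entry (row ∷ t) (suc r) c ≡ entry t r c
entry-∷ row t r c with nth t r
... | nothing = refl
... | just _ = refl

entry-columnTableau-0 : ∀ w r → entry (columnTableau w) r 0 ≡ nth w r
entry-columnTableau-0 [] r = refl
entry-columnTableau-0 (x ∷ w) zero = refl
entry-columnTableau-0 (x ∷ w) (suc r) = trans (entry-∷ (x ∷ []) (columnTableau w) r 0) (entry-columnTableau-0 w r)

entry-columnTableau-1 : ∀ w r → entry (columnTableau w) r 1 ≡ nothing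
entry-columnTableau-1 [] r = refl
entry-columnTableau-1 (x ∷ w) zero = refl
entry-columnTableau-1 (x ∷ w) (suc r) = trans (entry-∷ (x ∷ []) (columnTableau w) r 1) (entry-columnTableau-1 w r)

width-columnTableau : ∀ w → width (columnTableau w) ≤ 1
width-columnTableau [] = z≤n
width-columnTableau (x ∷ w) = ≤-reflexive (m≥n⇒m⊔n≡m (width-columnTableau w))

inversions-columnTableau : ∀ w → inversions (columnTableau w) ≡ listInversions w
inversions-columnTableau [] = refl
inversions-columnTableau (x ∷ w) =
  trans (cong (λ N → sum (map (columnInversions (columnTableau (x ∷ w))) (upTo N)))
              (m≥n⇒m⊔n≡m (width-columnTableau w)))
        (trans (+-identityʳ _) (columnInversions-0 (columnTableau (x ∷ w)) (x ∷ w) hookLike))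
  where
  hookLike : HookLike (columnTableau (x ∷ w)) (x ∷ w)
  hookLike = record
    { first-column = entry-columnTableau-0 (x ∷ w)
    ; second-column = λ r → entry-columnTableau-1 (x ∷ w) (suc r)
    ; length-≡ = length-map _ (x ∷ w)
    }

inversions-hookTableau : ∀ a b c → inversions (hookTableau a b c) ≡ listInversions (a ∷ c)
inversions-hookTableau a b c =
  trans (cong (λ N → sum (map (columnInversions (hookTableau a b c)) (upTo N)))
              (m≥n⇒m⊔n≡m (≤-trans (width-columnTableau c) (s≤s z≤n))))
  (trans (cong₂ _+_ (columnInversions-0 (hookTableau a b c) (a ∷ c) hookLike)
                    (trans (+-identityʳ _) (columnInversions-1 (hookTableau a b c) (a ∷ c) hookLike)))
         (+-identityʳ _))
  where
  first-column : ∀ r → entry (hookTableau a b c) r 0 ≡ nth (a ∷ c) r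
  first-column zero = refl
  first-column (suc r) = trans (entry-∷ (a ∷ b ∷ []) (columnTableau c) r 0) (entry-columnTableau-0 c r)
  hookLike : HookLike (hookTableau a b c) (a ∷ c)
  hookLike = record
    { first-column = first-column
    ; second-column = λ r → trans (entry-∷ (a ∷ b ∷ []) (columnTableau c) r 1) (entry-columnTableau-1 c r)
    ; length-≡ = cong suc (length-map _ c)
    }

-- Tableaux of the two shapes as Lehmer codes

inSᵇ-intro : ∀ i μ t → T (hasShapeᵇ μ t) → T (isFillingᵇ (size μ) t) → T (rowStandardᵇ t) →
             inversions t ≡ i → T (inSᵇ i μ t)
inSᵇ-intro i μ t shape filling rowStandard inv =
  T-∧-intro shape (T-∧-intro filling (T-∧-intro rowStandard (≡⇒≡ᵇ _ _ inv)))

inSᵇ⇒hasShape : ∀ i μ t → T (inSᵇ i μ t) → T (hasShapeᵇ μ t)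
inSᵇ⇒hasShape i μ t h = T-∧-proj₁ h

inSᵇ⇒isFilling : ∀ i μ t → T (inSᵇ i μ t) → T (isFillingᵇ (size μ) t)
inSᵇ⇒isFilling i μ t h = T-∧-proj₁ (T-∧-proj₂ {hasShapeᵇ μ t} h)

inSᵇ⇒rowStandard : ∀ i μ t → T (inSᵇ i μ t) → T (rowStandardᵇ t)
inSᵇ⇒rowStandard i μ t h = T-∧-proj₁ (T-∧-proj₂ {isFillingᵇ (size μ) t} (T-∧-proj₂ {hasShapeᵇ μ t} h))

inSᵇ⇒inversions : ∀ i μ t → T (inSᵇ i μ t) → inversions t ≡ i
inSᵇ⇒inversions i μ t h =
  ≡ᵇ⇒≡ _ _ (T-∧-proj₂ {rowStandardᵇ t} (T-∧-proj₂ {isFillingᵇ (size μ) t} (T-∧-proj₂ {hasShapeᵇ μ t} h)))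

size-column : ∀ m → size (column m) ≡ m
size-column zero = refl
size-column (suc m) = cong suc (size-column m)

concat-columnTableau : ∀ w → concat (columnTableau w) ≡ w
concat-columnTableau [] = refl
concat-columnTableau (x ∷ w) = cong (x ∷_) (concat-columnTableau w)

hasShape-column⇒ : ∀ m t → T (hasShapeᵇ (column m) t) → t ≡ columnTableau (concat t)
hasShape-column⇒ zero [] _ = refl
hasShape-column⇒ (suc m) ((x ∷ []) ∷ t) h = cong ((x ∷ []) ∷_) (hasShape-column⇒ m t h)

hasShape-columnTableau : ∀ w → T (hasShapeᵇ (column (length w)) (columnTableau w))
hasShape-columnTableau [] = tt
hasShape-columnTableau (x ∷ w) = hasShape-columnTableau w

rowStandard-columnTableau : ∀ w → T (rowStandardᵇ (columnTableau w))
rowStandard-columnTableau [] = tt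
rowStandard-columnTableau (x ∷ w) = rowStandard-columnTableau w

columnCodeᵇ : ∀ m → ℕ → Code m → Bool
columnCodeᵇ m i cs = digitSum m cs ≡ᵇ i

module ColumnCodes (m i : ℕ) where

  toCode : Tableau → Code m
  toCode t = encode m (concat t)

  fromCode : Code m → Tableau
  fromCode cs = columnTableau (decode m cs)

  fromCode-toCode : ∀ t → T (inSᵇ i (column m) t) → fromCode (toCode t) ≡ t
  fromCode-toCode t h = begin
    columnTableau (decode m (encode m (concat t))) ≡⟨ cong columnTableau (decode-encode m (concat t) filling) ⟩
    columnTableau (concat t)                      ≡⟨ sym (hasShape-column⇒ m t (inSᵇ⇒hasShape i (column m) t h)) ⟩
    t                                             ∎
    where
    open ≡-Reasoning
    filling : IsFilling m (concat t)
    filling = subst (λ N → IsFilling N (concat t)) (size-column m)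
                    (isFillingᵇ⇒IsFilling _ t (inSᵇ⇒isFilling i (column m) t h))

  toCode-fromCode : ∀ cs → toCode (fromCode cs) ≡ cs
  toCode-fromCode cs = trans (cong (encode m) (concat-columnTableau (decode m cs))) (encode-decode m cs)

  inversions-fromCode : ∀ cs → inversions (fromCode cs) ≡ digitSum m cs
  inversions-fromCode cs = trans (inversions-columnTableau (decode m cs)) (listInversions-decode m cs)

  fromCode-inS : ∀ cs → T (columnCodeᵇ m i cs) → T (inSᵇ i (column m) (fromCode cs))
  fromCode-inS cs h = inSᵇ-intro i (column m) (fromCode cs)
    (subst (λ k → T (hasShapeᵇ (column k) (fromCode cs))) (length-decode m cs) (hasShape-columnTableau (decode m cs)))
    (IsFilling⇒isFillingᵇ _ (fromCode cs)
      (subst₂ IsFilling (sym (size-column m)) (sym (concat-columnTableau (decode m cs))) (decode-IsFilling m cs)))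
    (rowStandard-columnTableau (decode m cs))
    (trans (inversions-fromCode cs) (≡ᵇ⇒≡ _ _ h))

  toCode-columnCode : ∀ t → T (inSᵇ i (column m) t) → T (columnCodeᵇ m i (toCode t))
  toCode-columnCode t h = ≡⇒≡ᵇ _ _ (begin
    digitSum m (toCode t)          ≡⟨ sym (inversions-fromCode (toCode t)) ⟩
    inversions (fromCode (toCode t)) ≡⟨ cong inversions (fromCode-toCode t h) ⟩
    inversions t                   ≡⟨ inSᵇ⇒inversions i (column m) t h ⟩
    i                              ∎)
    where open ≡-Reasoning

  S↔Code : S i (column m) ↔ Subtype (columnCodeᵇ m i)
  S↔Code = restrict-↔ (inSᵇ i (column m)) (columnCodeᵇ m i) toCode fromCode
    toCode-columnCode fromCode-inS fromCode-toCode (λ cs _ → toCode-fromCode cs)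

swapFirstTwo : List ℕ → List ℕ
swapFirstTwo (a ∷ b ∷ c) = b ∷ a ∷ c
swapFirstTwo l = l

hookFromList : List ℕ → Tableau
hookFromList (b ∷ a ∷ c) = hookTableau a b c
hookFromList _ = []

IsFilling-swapFirstTwo : ∀ N l → IsFilling N l → IsFilling N (swapFirstTwo l)
IsFilling-swapFirstTwo N [] h = h
IsFilling-swapFirstTwo N (a ∷ []) h = h
IsFilling-swapFirstTwo N (a ∷ b ∷ c) (len , occs) = len , λ k k<N →
  trans (x∙yz≈y∙xz (indicator (suc k ≡ᵇ b)) (indicator (suc k ≡ᵇ a)) (occ (suc k) c)) (occs k k<N)

hasShape-hook⇒ : ∀ n t → T (hasShapeᵇ (hook (suc (suc n))) t) → t ≡ hookFromList (swapFirstTwo (concat t))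
hasShape-hook⇒ n ((a ∷ b ∷ []) ∷ t) h = cong ((a ∷ b ∷ []) ∷_) (hasShape-column⇒ n t h)

hookCodeᵇ : ∀ n → ℕ → Code (suc (suc n)) → Bool
hookCodeᵇ n j (f , g , ds) = (toℕ g <ᵇ toℕ f) ∧ (toℕ g + digitSum n ds ≡ᵇ j)

module HookCodes (n j : ℕ) where

  m : ℕ
  m = suc (suc n)

  toCode : Tableau → Code m
  toCode t = encode m (swapFirstTwo (concat t))

  fromCode : Code m → Tableau
  fromCode cs = hookFromList (decode m cs)

  fromCode-toCode : ∀ t → T (inSᵇ j (hook m) t) → fromCode (toCode t) ≡ t
  fromCode-toCode t h = begin
    hookFromList (decode m (encode m (swapFirstTwo (concat t))))
      ≡⟨ cong hookFromList (decode-encode m _ filling) ⟩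
    hookFromList (swapFirstTwo (concat t))
      ≡⟨ sym (hasShape-hook⇒ n t (inSᵇ⇒hasShape j (hook m) t h)) ⟩
    t ∎
    where
    open ≡-Reasoning
    filling : IsFilling m (swapFirstTwo (concat t))
    filling = IsFilling-swapFirstTwo m (concat t)
      (subst (λ N → IsFilling N (concat t)) (cong (λ k → suc (suc k)) (size-column n))
             (isFillingᵇ⇒IsFilling _ t (inSᵇ⇒isFilling j (hook m) t h)))

  toCode-fromCode : ∀ cs → toCode (fromCode cs) ≡ cs
  toCode-fromCode (f , g , ds) =
    trans (cong (λ c → encode m (suc (toℕ f) ∷ bump (toℕ f) (suc (toℕ g)) ∷ c)) (concat-columnTableau _))
          (encode-decode m (f , g , ds))

  inversions-fromCode : ∀ f g ds → inversions (fromCode (f , g , ds)) ≡ toℕ g + digitSum n ds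
  inversions-fromCode f g ds = begin
    inversions (fromCode (f , g , ds))
      ≡⟨ inversions-hookTableau (bump (toℕ f) (suc (toℕ g))) (suc (toℕ f)) c ⟩
    listInversions (map (bump (toℕ f)) (decode (suc n) (g , ds)))
      ≡⟨ listInversions-map-bump (toℕ f) (decode (suc n) (g , ds)) ⟩
    listInversions (decode (suc n) (g , ds))
      ≡⟨ listInversions-decode (suc n) (g , ds) ⟩
    toℕ g + digitSum n ds ∎
    where
    open ≡-Reasoning
    c : List ℕ
    c = map (bump (toℕ f)) (map (bump (toℕ g)) (decode n ds))

  rowStandard-fromCode⇒ : ∀ f g ds → T (rowStandardᵇ (fromCode (f , g , ds))) → toℕ g < toℕ f
  rowStandard-fromCode⇒ f g ds h with toℕ g <? toℕ f
  ... | yes g<f = g<f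
  ... | no g≮f = ⊥-elim (<⇒≱ (s<s⁻¹ a<b) (≤-trans (≮⇒≥ g≮f) (n≤1+n _)))
    where
    a<b : suc (suc (toℕ g)) < suc (toℕ f)
    a<b = subst (_< suc (toℕ f)) (bump-> (s≤s (≮⇒≥ g≮f))) (<ᵇ⇒< _ _ (T-∧-proj₁ (T-∧-proj₁ h)))

  rowStandard-fromCode⇐ : ∀ f g ds → toℕ g < toℕ f → T (rowStandardᵇ (fromCode (f , g , ds)))
  rowStandard-fromCode⇐ f g ds g<f rewrite bump-≤ {toℕ f} {suc (toℕ g)} g<f =
    T-∧-intro (T-∧-intro (<⇒<ᵇ (s≤s g<f)) tt)
              (rowStandard-columnTableau (map (bump (toℕ f)) (map (bump (toℕ g)) (decode n ds))))

  toCode-hookCode : ∀ t → T (inSᵇ j (hook m) t) → T (hookCodeᵇ n j (toCode t))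
  toCode-hookCode t h with toCode t | fromCode-toCode t h
  ... | (f , g , ds) | e = T-∧-intro
    (<⇒<ᵇ (rowStandard-fromCode⇒ f g ds (subst (λ x → T (rowStandardᵇ x)) (sym e) (inSᵇ⇒rowStandard j (hook m) t h))))
    (≡⇒≡ᵇ _ _ (trans (sym (inversions-fromCode f g ds)) (trans (cong inversions e) (inSᵇ⇒inversions j (hook m) t h))))

  fromCode-inS : ∀ cs → T (hookCodeᵇ n j cs) → T (inSᵇ j (hook m) (fromCode cs))
  fromCode-inS (f , g , ds) h = inSᵇ-intro j (hook m) (fromCode (f , g , ds))
    (subst (λ k → T (hasShapeᵇ (column k) (columnTableau c))) length-c (hasShape-columnTableau c))
    (IsFilling⇒isFillingᵇ _ (fromCode (f , g , ds))
      (subst₂ IsFilling (cong (λ k → suc (suc k)) (sym (size-column n)))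
                        (cong (λ z → bump (toℕ f) (suc (toℕ g)) ∷ suc (toℕ f) ∷ z) (sym (concat-columnTableau c)))
        (IsFilling-swapFirstTwo m (decode m (f , g , ds)) (decode-IsFilling m (f , g , ds)))))
    (rowStandard-fromCode⇐ f g ds (<ᵇ⇒< _ _ (T-∧-proj₁ h)))
    (trans (inversions-fromCode f g ds) (≡ᵇ⇒≡ _ _ (T-∧-proj₂ {toℕ g <ᵇ toℕ f} h)))
    where
    c : List ℕ
    c = map (bump (toℕ f)) (map (bump (toℕ g)) (decode n ds))
    length-c : length c ≡ n
    length-c = trans (length-map (bump (toℕ f)) (map (bump (toℕ g)) (decode n ds)))
                     (trans (length-map (bump (toℕ g)) (decode n ds)) (length-decode n ds))

  S↔Code : S j (hook m) ↔ Subtype (hookCodeᵇ n j)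
  S↔Code = restrict-↔ (inSᵇ j (hook m)) (hookCodeᵇ n j) toCode fromCode
    toCode-hookCode fromCode-inS fromCode-toCode (λ cs _ → toCode-fromCode cs)

-- The bijection of codes

n≤Tri : ∀ n → n ≤ Tri n
n≤Tri zero = z≤n
n≤Tri (suc n) = m≤m+n (suc n) (Tri n)

digitSum+n≤Tri : ∀ n cs → digitSum n cs + n ≤ Tri n
digitSum+n≤Tri zero tt = z≤n
digitSum+n≤Tri (suc n) (f , cs) = begin
  toℕ f + digitSum n cs + suc n   ≡⟨ +-comm (toℕ f + digitSum n cs) (suc n) ⟩
  suc n + (toℕ f + digitSum n cs) ≤⟨ +-monoʳ-≤ (suc n) (+-monoˡ-≤ (digitSum n cs) (toℕ≤pred[n] f)) ⟩
  suc n + (n + digitSum n cs)     ≡⟨ cong (suc n +_) (+-comm n (digitSum n cs)) ⟩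
  suc n + (digitSum n cs + n)     ≤⟨ +-monoʳ-≤ (suc n) (digitSum+n≤Tri n cs) ⟩
  suc n + Tri n                   ∎
  where open ≤-Reasoning

-- The second digits G of a column code and H of a hook code correspond when F + G = H + (n + 1),
-- F being their common first digit.
module Shift (n F G H : ℕ) (shift : F + G ≡ H + suc n) where

  shift-+ : ∀ s → F + (G + s) ≡ suc n + (H + s)
  shift-+ s = begin
    F + (G + s)     ≡⟨ sym (+-assoc F G s) ⟩
    F + G + s       ≡⟨ cong (_+ s) shift ⟩
    H + suc n + s   ≡⟨ cong (_+ s) (+-comm H (suc n)) ⟩
    suc n + H + s   ≡⟨ +-assoc (suc n) H s ⟩
    suc n + (H + s) ∎
    where open ≡-Reasoning

  G≤n⇒H<F : G ≤ n → H < F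
  G≤n⇒H<F G≤n = +-cancelʳ-≤ n (suc H) F (begin
    suc H + n ≡⟨ sym (+-suc H n) ⟩
    H + suc n ≡⟨ sym shift ⟩
    F + G     ≤⟨ +-monoʳ-≤ F G≤n ⟩
    F + n     ∎)
    where open ≤-Reasoning

  H<F⇒G≤n : H < F → G ≤ n
  H<F⇒G≤n H<F = +-cancelˡ-≤ F G n (begin
    F + G     ≡⟨ shift ⟩
    H + suc n ≡⟨ +-suc H n ⟩
    suc H + n ≤⟨ +-monoˡ-≤ n H<F ⟩
    F + n     ∎)
    where open ≤-Reasoning

  sum⇒ : ∀ s i → F + (G + s) ≡ i → H + s ≡ i ∸ suc n
  sum⇒ s i refl = sym (trans (cong (_∸ suc n) (shift-+ s)) (m+n∸m≡n (suc n) (H + s)))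

  sum⇐ : ∀ s i → suc n ≤ i → H + s ≡ i ∸ suc n → F + (G + s) ≡ i
  sum⇐ s i n<i e = trans (shift-+ s) (trans (cong (suc n +_) e) (m+[n∸m]≡n n<i))

  H≡ : F + G ∸ suc n ≡ H
  H≡ = trans (cong (_∸ suc n) shift) (m+n∸n≡m H (suc n))

  G≡ : H + suc n ∸ F ≡ G
  G≡ = trans (cong (_∸ F) (sym shift)) (m+n∸m≡n F G)

module CodeShift (n i : ℕ) (Tri<i : Tri n < i) where

  m : ℕ
  m = suc (suc n)

  toHookCode : Code m → Code m
  toHookCode (f , g , ds) = f , clamp n (toℕ f + toℕ g ∸ suc n) , ds

  fromHookCode : Code m → Code m
  fromHookCode (f , h , ds) = f , clamp n (toℕ h + suc n ∸ toℕ f) , ds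

  -- The large inversion number forces F + G ≥ n + 1, since the other digits contribute at most T_n − n.
  column-shift : ∀ f g ds → T (columnCodeᵇ m i (f , g , ds)) →
                 toℕ f + toℕ g ≡ (toℕ f + toℕ g ∸ suc n) + suc n
  column-shift f g ds h = sym (m∸n+n≡m (+-cancelʳ-≤ s (suc n) (F + G) (begin
    suc n + s      ≡⟨ cong suc (+-comm n s) ⟩
    suc (s + n)    ≤⟨ s≤s (digitSum+n≤Tri n ds) ⟩
    suc (Tri n)    ≤⟨ Tri<i ⟩
    i              ≡⟨ sym (≡ᵇ⇒≡ _ _ h) ⟩
    F + (G + s)    ≡⟨ sym (+-assoc F G s) ⟩
    F + G + s      ∎)))
    where
    open ≤-Reasoning
    F : ℕ
    F = toℕ f
    G : ℕ
    G = toℕ g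
    s : ℕ
    s = digitSum n ds

  hook-shift : ∀ (f : Fin m) (h : Fin (suc n)) → toℕ f + (toℕ h + suc n ∸ toℕ f) ≡ toℕ h + suc n
  hook-shift f h = m+[n∸m]≡n (≤-trans (toℕ≤pred[n] f) (m≤n+m (suc n) (toℕ h)))

  n<i : suc n ≤ i
  n<i = ≤-<-trans (n≤Tri n) Tri<i

  module ColumnShift (f : Fin m) (g : Fin (suc n)) (ds : Code n) (h : T (columnCodeᵇ m i (f , g , ds))) =
    Shift n (toℕ f) (toℕ g) (toℕ f + toℕ g ∸ suc n) (column-shift f g ds h)

  module HookShift (f : Fin m) (h : Fin (suc n)) =
    Shift n (toℕ f) (toℕ h + suc n ∸ toℕ f) (toℕ h) (hook-shift f h)

  column-H<F : ∀ f g ds → T (columnCodeᵇ m i (f , g , ds)) → toℕ f + toℕ g ∸ suc n < toℕ f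
  column-H<F f g ds h = ColumnShift.G≤n⇒H<F f g ds h (toℕ≤pred[n] g)

  column-H≤n : ∀ f g ds → T (columnCodeᵇ m i (f , g , ds)) → toℕ f + toℕ g ∸ suc n ≤ n
  column-H≤n f g ds h = s≤s⁻¹ (≤-trans (column-H<F f g ds h) (toℕ≤pred[n] f))

  hook-G≤n : ∀ f h ds → T (hookCodeᵇ n (i ∸ suc n) (f , h , ds)) → toℕ h + suc n ∸ toℕ f ≤ n
  hook-G≤n f h ds p = HookShift.H<F⇒G≤n f h (<ᵇ⇒< _ _ (T-∧-proj₁ p))

  toHookCode-hookCode : ∀ cs → T (columnCodeᵇ m i cs) → T (hookCodeᵇ n (i ∸ suc n) (toHookCode cs))
  toHookCode-hookCode (f , g , ds) h rewrite toℕ-clamp n (column-H≤n f g ds h) =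
    T-∧-intro (<⇒<ᵇ (column-H<F f g ds h))
              (≡⇒≡ᵇ _ _ (ColumnShift.sum⇒ f g ds h (digitSum n ds) i (≡ᵇ⇒≡ _ _ h)))

  fromHookCode-columnCode : ∀ cs → T (hookCodeᵇ n (i ∸ suc n) cs) → T (columnCodeᵇ m i (fromHookCode cs))
  fromHookCode-columnCode (f , h , ds) p rewrite toℕ-clamp n (hook-G≤n f h ds p) =
    ≡⇒≡ᵇ _ _ (HookShift.sum⇐ f h (digitSum n ds) i n<i (≡ᵇ⇒≡ _ _ (T-∧-proj₂ {toℕ h <ᵇ toℕ f} p)))

  fromHookCode-toHookCode : ∀ cs → T (columnCodeᵇ m i cs) → fromHookCode (toHookCode cs) ≡ cs
  fromHookCode-toHookCode (f , g , ds) h rewrite toℕ-clamp n (column-H≤n f g ds h) =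
    cong (λ x → f , x , ds) (trans (cong (clamp n) (ColumnShift.G≡ f g ds h)) (clamp-toℕ n g))

  toHookCode-fromHookCode : ∀ cs → T (hookCodeᵇ n (i ∸ suc n) cs) → toHookCode (fromHookCode cs) ≡ cs
  toHookCode-fromHookCode (f , h , ds) p rewrite toℕ-clamp n (hook-G≤n f h ds p) =
    cong (λ x → f , x , ds) (trans (cong (clamp n) (HookShift.H≡ f h)) (clamp-toℕ n h))

  ColumnCode↔HookCode : Subtype (columnCodeᵇ m i) ↔ Subtype (hookCodeᵇ n (i ∸ suc n))
  ColumnCode↔HookCode = restrict-↔ (columnCodeᵇ m i) (hookCodeᵇ n (i ∸ suc n)) toHookCode fromHookCode
    toHookCode-hookCode fromHookCode-columnCode fromHookCode-toHookCode toHookCode-fromHookCode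

top-entry-toHookCode : ∀ n i j (Tri<i : Tri n < i) cs →
  entry (ColumnCodes.fromCode (suc (suc n)) i cs) 0 0 ≡
  entry (HookCodes.fromCode n j (CodeShift.toHookCode n i Tri<i cs)) 0 1
top-entry-toHookCode n i j Tri<i (f , g , ds) = refl

lemma4p3 : (m : ℕ) → 2 ≤ m → (i : ℕ) → Tri (m ∸ 2) < i →
    (Σ ℕ (λ n → (S i (column m) ↔ Fin n) × (S (i ∸ (m ∸ 1)) (hook m) ↔ Fin n)))
    × Σ (S i (column m) ↔ S (i ∸ (m ∸ 1)) (hook m))
        (λ φ → (τ : S i (column m)) →
           entry (proj₁ τ) 0 0 ≡ entry (proj₁ (Inverse.to φ τ)) 0 1)
lemma4p3 (suc zero) (s≤s ()) _ _
lemma4p3 (suc (suc n)) _ i Tri<i = (proj₁ finite , proj₂ finite , proj₂ finite ↔-∘ ↔-sym φ) , φ , top-entry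
  where
  m : ℕ
  m = suc (suc n)
  φ : S i (column m) ↔ S (i ∸ suc n) (hook m)
  φ = ↔-sym (HookCodes.S↔Code n (i ∸ suc n))
      ↔-∘ (CodeShift.ColumnCode↔HookCode n i Tri<i ↔-∘ ColumnCodes.S↔Code m i)
  finite : Finite (S i (column m))
  finite = Finite-↔ (ColumnCodes.S↔Code m i) (Finite-Subtype-Code m (columnCodeᵇ m i))
  top-entry : ∀ τ → entry (proj₁ τ) 0 0 ≡ entry (proj₁ (Inverse.to φ τ)) 0 1
  top-entry (t , h) = trans (cong (λ x → entry x 0 0) (sym (ColumnCodes.fromCode-toCode m i t h)))
                            (top-entry-toHookCode n i (i ∸ suc n) Tri<i (ColumnCodes.toCode m i t))
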